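{- Let $S$ be any set of codes of formulae of $\mathcal{L}_\mathrm{Tr}$. Then $S\subseteq\Theta(S)$.
   Context: $\mathcal{L}_\mathbb{N}$ is the language of Peano arithmetic extended with finitely many function symbols for primitive recursive functions, among them symbols for syntactic operations on Gödel codes: $\dot\neg,\dot\vee,\dot\wedge,\dot\forall,\dot\exists,\dot\rightarrow$ (forming codes of negations, disjunctions, etc.; $\varphi\rightarrow\psi$ abbreviates $\neg\varphi\vee\psi$), $\dot{\mathrm{Tr}}$ (sending the code of a closed term $t$ to the code of $\mathrm{Tr}(t)$), substitution $y(z/v)$ (substituting the numeral of $z$, or the term coded by $z$, for the variable $v$ in the formula coded by $y$). $\mathcal{L}_\mathrm{Tr}=\mathcal{L}_\mathbb{N}\cup\{\mathrm{Tr}\}$, $\mathrm{Tr}$ unary. $\mathrm{PAT}$ is Peano arithmetic formulated in $\mathcal{L}_\mathrm{Tr}$ with induction for all $\mathcal{L}_\mathrm{Tr}$-formulas. $\#\varphi$ is the Gödel number of $\varphi$, $\ulcorner\varphi\urcorner$ its numeral; $t^\circ$ denotes the value of the closed term coded by $t$; $\mathrm{Sent}(x)$ represents the set of codes of $\mathcal{L}_\mathrm{Tr}$-sentences; $\mathrm{Pr}_{\mathrm{PAT}}(x)$ is a standard provability predicate of $\mathrm{PAT}$; $\mathrm{True}_0$ is the set of codes of true literals of $\mathcal{L}_\mathbb{N}$. $\xi(x,X)$ is the arithmetical formula with set parameter $X$ that is the disjunction of: $x\in\mathrm{True}_0$; $\exists y(x=\dot\neg\dot\neg y\wedge y\in X)$;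 $\exists y,z(x=y\dot\vee z\wedge(y\in X\vee z\in X))$; $\exists y,z(x=\dot\neg(y\dot\vee z)\wedge\dot\neg y\in X\wedge\dot\neg z\in X)$; $\exists y,z(x=y\dot\wedge z\wedge y\in X\wedge z\in X)$; $\exists y,z(x=\dot\neg(y\dot\wedge z)\wedge(\dot\neg y\in X\vee\dot\neg z\in X))$; $\exists y,v(x=\dot\forall vy\wedge\forall z(y(z/v)\in X))$; $\exists y,v(x=\dot\neg\dot\forall vy\wedge\exists z(\dot\neg y(z/v)\in X))$; $\exists y,v(x=\dot\exists vy\wedge\exists z(y(z/v)\in X))$; $\exists y,v(x=\dot\neg\dot\exists vy\wedge\forall z(\dot\neg y(z/v)\in X))$; $\exists t(x=\dot{\mathrm{Tr}}(t)\wedge t^\circ\in X)$; $\exists t(x=\dot\neg\dot{\mathrm{Tr}}(t)\wedge(\dot\neg t^\circ\in X\vee\neg\mathrm{Sent}(t^\circ)))$, where $t$ ranges over codes of closed terms. The operator $\Theta:\mathcal{P}(\omega)\to\mathcal{P}(\omega)$ is $\Theta(S)=\{n\in\omega:\mathbb{N}\vDash\exists y(\xi(y,S)\wedge\mathrm{Pr}_{\mathrm{PAT}}(y\dot\rightarrow \bar n))\}$. -}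

module Defs where

open import Data.Nat using (ℕ; zero; suc; _+_; _*_; _≟_)
open import Data.Nat.DivMod using (_/_)
open import Data.Bool using (Bool; true; false; not; _∨_; _∧_; if_then_else_)
open import Data.Maybe using (Maybe; just; nothing; _>>=_; maybe)
open import Data.Product using (Σ; _×_; _,_)
open import Data.Sum using (_⊎_)
open import Relation.Nullary using (¬_; does)
open import Relation.Binary.PropositionalEquality using (_≡_; _≢_)

-- Syntax of L_Tr  (L_N = {0, S, +, ×} with '=', plus unary Tr).
-- Variables are indexed by ℕ.  φ → ψ abbreviates ¬φ ∨ ψ.

data Term : Set where
  var  : ℕ → Term
  zeroᵗ : Term
  sucᵗ  : Term → Term
  _+ᵗ_ : Term → Term → Term
  _*ᵗ_ : Term → Term → Term

data Formula : Set where
  _≐_  : Term → Term → Formula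
  Tr   : Term → Formula
  ¬ᶠ_  : Formula → Formula
  _∨ᶠ_ : Formula → Formula → Formula
  _∧ᶠ_ : Formula → Formula → Formula
  ∀ᶠ   : ℕ → Formula → Formula
  ∃ᶠ   : ℕ → Formula → Formula

infixr 5 _⇒_
infix 8 ¬ᶠ_
infixr 6 _∨ᶠ_ _∧ᶠ_
infix 7 _≐_

_⇒_ : Formula → Formula → Formula
φ ⇒ ψ = (¬ᶠ φ) ∨ᶠ ψ

num : ℕ → Term
num zero    = zeroᵗ
num (suc n) = sucᵗ (num n)

data FreeT (x : ℕ) : Term → Set where
  fvar : FreeT x (var x)
  fsuc : ∀ {t} → FreeT x t → FreeT x (sucᵗ t)
  f+l  : ∀ {s t} → FreeT x s → FreeT x (s +ᵗ t)
  f+r  : ∀ {s t} → FreeT x t → FreeT x (s +ᵗ t)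
  f*l  : ∀ {s t} → FreeT x s → FreeT x (s *ᵗ t)
  f*r  : ∀ {s t} → FreeT x t → FreeT x (s *ᵗ t)

data Free (x : ℕ) : Formula → Set where
  f≐l : ∀ {s t} → FreeT x s → Free x (s ≐ t)
  f≐r : ∀ {s t} → FreeT x t → Free x (s ≐ t)
  fTr : ∀ {t} → FreeT x t → Free x (Tr t)
  f¬  : ∀ {φ} → Free x φ → Free x (¬ᶠ φ)
  f∨l : ∀ {φ ψ} → Free x φ → Free x (φ ∨ᶠ ψ)
  f∨r : ∀ {φ ψ} → Free x ψ → Free x (φ ∨ᶠ ψ)
  f∧l : ∀ {φ ψ} → Free x φ → Free x (φ ∧ᶠ ψ)
  f∧r : ∀ {φ ψ} → Free x ψ → Free x (φ ∧ᶠ ψ)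
  f∀  : ∀ {y φ} → x ≢ y → Free x φ → Free x (∀ᶠ y φ)
  f∃  : ∀ {y φ} → x ≢ y → Free x φ → Free x (∃ᶠ y φ)

ClosedT : Term → Set
ClosedT t = ∀ x → ¬ FreeT x t

Closed : Formula → Set
Closed φ = ∀ x → ¬ Free x φ

substT : Term → ℕ → Term → Term
substT (var y) x t = if does (y ≟ x) then t else var y
substT zeroᵗ x t = zeroᵗ
substT (sucᵗ s) x t = sucᵗ (substT s x t)
substT (s₁ +ᵗ s₂) x t = substT s₁ x t +ᵗ substT s₂ x t
substT (s₁ *ᵗ s₂) x t = substT s₁ x t *ᵗ substT s₂ x t

_[_/_] : Formula → Term → ℕ → Formula
(s ≐ u) [ t / x ] = substT s x t ≐ substT u x t
Tr s [ t / x ] = Tr (substT s x t)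
(¬ᶠ φ) [ t / x ] = ¬ᶠ (φ [ t / x ])
(φ ∨ᶠ ψ) [ t / x ] = (φ [ t / x ]) ∨ᶠ (ψ [ t / x ])
(φ ∧ᶠ ψ) [ t / x ] = (φ [ t / x ]) ∧ᶠ (ψ [ t / x ])
∀ᶠ y φ [ t / x ] = if does (y ≟ x) then ∀ᶠ y φ else ∀ᶠ y (φ [ t / x ])
∃ᶠ y φ [ t / x ] = if does (y ≟ x) then ∃ᶠ y φ else ∃ᶠ y (φ [ t / x ])

data Substitutable (t : Term) (x : ℕ) : Formula → Set where
  s≐ : ∀ {s u} → Substitutable t x (s ≐ u)
  sTr : ∀ {s} → Substitutable t x (Tr s)
  s¬ : ∀ {φ} → Substitutable t x φ → Substitutable t x (¬ᶠ φ)
  s∨ : ∀ {φ ψ} → Substitutable t x φ → Substitutable t x ψ → Substitutable t x (φ ∨ᶠ ψ)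
  s∧ : ∀ {φ ψ} → Substitutable t x φ → Substitutable t x ψ → Substitutable t x (φ ∧ᶠ ψ)
  s∀-nofree : ∀ {y φ} → ¬ Free x (∀ᶠ y φ) → Substitutable t x (∀ᶠ y φ)
  s∀ : ∀ {y φ} → ¬ FreeT y t → Substitutable t x φ → Substitutable t x (∀ᶠ y φ)
  s∃-nofree : ∀ {y φ} → ¬ Free x (∃ᶠ y φ) → Substitutable t x (∃ᶠ y φ)
  s∃ : ∀ {y φ} → ¬ FreeT y t → Substitutable t x φ → Substitutable t x (∃ᶠ y φ)

evalT : (ℕ → ℕ) → Term → ℕ
evalT ρ (var x) = ρ x
evalT ρ zeroᵗ = zero
evalT ρ (sucᵗ t) = suc (evalT ρ t)
evalT ρ (s +ᵗ t) = evalT ρ s + evalT ρ t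
evalT ρ (s *ᵗ t) = evalT ρ s * evalT ρ t

_° : Term → ℕ
t ° = evalT (λ _ → zero) t

-- Gödel coding (Cantor pairing with a tag in the first component)

pair : ℕ → ℕ → ℕ
pair a b = ((a + b) * suc (a + b)) / 2 + b

unpair : ℕ → ℕ × ℕ
unpair zero = 0 , 0
unpair (suc n) with unpair n
... | zero , b = suc b , 0
... | suc a , b = a , suc b

encT : Term → ℕ
encT (var x) = pair 0 x
encT zeroᵗ = pair 1 0
encT (sucᵗ t) = pair 2 (encT t)
encT (s +ᵗ t) = pair 3 (pair (encT s) (encT t))
encT (s *ᵗ t) = pair 4 (pair (encT s) (encT t))

eq˙ : ℕ → ℕ → ℕ
eq˙ s t = pair 0 (pair s t)
Tr˙ : ℕ → ℕ
Tr˙ t = pair 1 t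
¬˙ : ℕ → ℕ
¬˙ y = pair 2 y
_∨˙_ : ℕ → ℕ → ℕ
y ∨˙ z = pair 3 (pair y z)
_∧˙_ : ℕ → ℕ → ℕ
y ∧˙ z = pair 4 (pair y z)
∀˙ : ℕ → ℕ → ℕ
∀˙ v y = pair 5 (pair v y)
∃˙ : ℕ → ℕ → ℕ
∃˙ v y = pair 6 (pair v y)
_→˙_ : ℕ → ℕ → ℕ
y →˙ z = (¬˙ y) ∨˙ z

enc : Formula → ℕ
enc (s ≐ t) = eq˙ (encT s) (encT t)
enc (Tr t) = Tr˙ (encT t)
enc (¬ᶠ φ) = ¬˙ (enc φ)
enc (φ ∨ᶠ ψ) = enc φ ∨˙ enc ψ
enc (φ ∧ᶠ ψ) = enc φ ∧˙ enc ψ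
enc (∀ᶠ v φ) = ∀˙ v (enc φ)
enc (∃ᶠ v φ) = ∃˙ v (enc φ)

-- decoding with fuel (fuel = the code itself suffices, components are smaller)
decT : ℕ → ℕ → Maybe Term
decT zero n = nothing
decT (suc k) n with unpair n
... | 0 , x = just (var x)
... | 1 , 0 = just zeroᵗ
... | 1 , suc _ = nothing
... | 2 , m = decT k m >>= λ t → just (sucᵗ t)
... | 3 , m with unpair m
...   | a , b = decT k a >>= λ s → decT k b >>= λ t → just (s +ᵗ t)
decT (suc k) n | 4 , m with unpair m
...   | a , b = decT k a >>= λ s → decT k b >>= λ t → just (s *ᵗ t)
decT (suc k) n | suc (suc (suc (suc (suc _)))) , _ = nothing

decF : ℕ → ℕ → Maybe Formula
decF zero n = nothing
decF (suc k) n with unpair n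
... | 0 , m with unpair m
...   | a , b = decT (suc k) a >>= λ s → decT (suc k) b >>= λ t → just (s ≐ t)
decF (suc k) n | 1 , m = decT (suc k) m >>= λ t → just (Tr t)
decF (suc k) n | 2 , m = decF k m >>= λ φ → just (¬ᶠ φ)
decF (suc k) n | 3 , m with unpair m
...   | a , b = decF k a >>= λ φ → decF k b >>= λ ψ → just (φ ∨ᶠ ψ)
decF (suc k) n | 4 , m with unpair m
...   | a , b = decF k a >>= λ φ → decF k b >>= λ ψ → just (φ ∧ᶠ ψ)
decF (suc k) n | 5 , m with unpair m
...   | v , b = decF k b >>= λ φ → just (∀ᶠ v φ)
decF (suc k) n | 6 , m with unpair m
...   | v , b = decF k b >>= λ φ → just (∃ᶠ v φ)
decF (suc k) n | suc (suc (suc (suc (suc (suc (suc _)))))) , _ = nothing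

decode : ℕ → Maybe Formula
decode n = decF (suc n) n

-- y(z/v): substitute the numeral of z for the variable v in the formula coded by y
-- (value 0 on non-codes)
sub : ℕ → ℕ → ℕ → ℕ
sub y z v = maybe (λ φ → enc (φ [ num z / v ])) 0 (decode y)

Sent : ℕ → Set
Sent x = Σ Formula λ φ → enc φ ≡ x × Closed φ

FormulaCode : ℕ → Set
FormulaCode x = Σ Formula λ φ → enc φ ≡ x

True₀ : ℕ → Set
True₀ x = Σ Term λ s → Σ Term λ t → ClosedT s × ClosedT t ×
          ((x ≡ enc (s ≐ t) × s ° ≡ t °) ⊎ (x ≡ enc (¬ᶠ (s ≐ t)) × s ° ≢ t °))

-- propositional evaluation; prime formulas (atomic, Tr, quantified) get values from v
evalP : (Formula → Bool) → Formula → Bool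
evalP v (¬ᶠ φ) = not (evalP v φ)
evalP v (φ ∨ᶠ ψ) = evalP v φ ∨ evalP v ψ
evalP v (φ ∧ᶠ ψ) = evalP v φ ∧ evalP v ψ
evalP v φ = v φ

Tautology : Formula → Set
Tautology φ = (v : Formula → Bool) → evalP v φ ≡ true

data Atomic : Formula → Set where
  at≐  : ∀ {s t} → Atomic (s ≐ t)
  atTr : ∀ {t} → Atomic (Tr t)

data LogicalAxiom : Formula → Set where
  taut   : ∀ {φ} → Tautology φ → LogicalAxiom φ
  inst   : ∀ {φ x t} → Substitutable t x φ → LogicalAxiom (∀ᶠ x φ ⇒ (φ [ t / x ]))
  ∀-dist : ∀ {φ ψ x} → ¬ Free x φ → LogicalAxiom (∀ᶠ x (φ ⇒ ψ) ⇒ (φ ⇒ ∀ᶠ x ψ))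
  ∃-def₁ : ∀ {φ x} → LogicalAxiom (∃ᶠ x φ ⇒ ¬ᶠ ∀ᶠ x (¬ᶠ φ))
  ∃-def₂ : ∀ {φ x} → LogicalAxiom (¬ᶠ ∀ᶠ x (¬ᶠ φ) ⇒ ∃ᶠ x φ)
  eq-refl : ∀ {x} → LogicalAxiom (var x ≐ var x)
  eq-subst : ∀ {α x y z} → Atomic α →
             LogicalAxiom ((var x ≐ var y) ⇒ ((α [ var x / z ]) ⇒ (α [ var y / z ])))

x₀ x₁ : Term
x₀ = var 0
x₁ = var 1

data PATAxiom : Formula → Set where
  ax-S0   : PATAxiom (¬ᶠ (sucᵗ x₀ ≐ zeroᵗ))
  ax-Sinj : PATAxiom ((sucᵗ x₀ ≐ sucᵗ x₁) ⇒ (x₀ ≐ x₁))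
  ax-+0   : PATAxiom ((x₀ +ᵗ zeroᵗ) ≐ x₀)
  ax-+S   : PATAxiom ((x₀ +ᵗ sucᵗ x₁) ≐ sucᵗ (x₀ +ᵗ x₁))
  ax-*0   : PATAxiom ((x₀ *ᵗ zeroᵗ) ≐ zeroᵗ)
  ax-*S   : PATAxiom ((x₀ *ᵗ sucᵗ x₁) ≐ ((x₀ *ᵗ x₁) +ᵗ x₀))
  ax-ind  : ∀ φ v → PATAxiom ((φ [ zeroᵗ / v ]) ⇒
                      (∀ᶠ v (φ ⇒ (φ [ sucᵗ (var v) / v ])) ⇒ ∀ᶠ v φ))

data PAT⊢_ : Formula → Set where
  logical : ∀ {φ} → LogicalAxiom φ → PAT⊢ φ
  nonlogical : ∀ {φ} → PATAxiom φ → PAT⊢ φ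
  mp  : ∀ {φ ψ} → PAT⊢ φ → PAT⊢ (φ ⇒ ψ) → PAT⊢ ψ
  gen : ∀ {φ} x → PAT⊢ φ → PAT⊢ ∀ᶠ x φ

Pr-PAT : ℕ → Set
Pr-PAT x = Σ Formula λ φ → enc φ ≡ x × PAT⊢ φ

ξ : ℕ → (ℕ → Set) → Set
ξ x X =
     True₀ x
  ⊎ (Σ ℕ λ y → x ≡ ¬˙ (¬˙ y) × X y)
  ⊎ (Σ ℕ λ y → Σ ℕ λ z → x ≡ y ∨˙ z × (X y ⊎ X z))
  ⊎ (Σ ℕ λ y → Σ ℕ λ z → x ≡ ¬˙ (y ∨˙ z) × X (¬˙ y) × X (¬˙ z))
  ⊎ (Σ ℕ λ y → Σ ℕ λ z → x ≡ y ∧˙ z × X y × X z)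
  ⊎ (Σ ℕ λ y → Σ ℕ λ z → x ≡ ¬˙ (y ∧˙ z) × (X (¬˙ y) ⊎ X (¬˙ z)))
  ⊎ (Σ ℕ λ y → Σ ℕ λ v → x ≡ ∀˙ v y × ((z : ℕ) → X (sub y z v)))
  ⊎ (Σ ℕ λ y → Σ ℕ λ v → x ≡ ¬˙ (∀˙ v y) × Σ ℕ λ z → X (¬˙ (sub y z v)))
  ⊎ (Σ ℕ λ y → Σ ℕ λ v → x ≡ ∃˙ v y × Σ ℕ λ z → X (sub y z v))
  ⊎ (Σ ℕ λ y → Σ ℕ λ v → x ≡ ¬˙ (∃˙ v y) × ((z : ℕ) → X (¬˙ (sub y z v))))
  ⊎ (Σ Term λ t → ClosedT t × x ≡ Tr˙ (encT t) × X (t °))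
  ⊎ (Σ Term λ t → ClosedT t × x ≡ ¬˙ (Tr˙ (encT t)) × (X (¬˙ (t °)) ⊎ ¬ Sent (t °)))

Θ : (ℕ → Set) → (ℕ → Set)
Θ S n = Σ ℕ λ y → ξ y S × Pr-PAT (y →˙ n)

_⊆_ : (ℕ → Set) → (ℕ → Set) → Set
A ⊆ B = ∀ n → A n → B n

{-# OPTIONS --safe #-}
module Submission where

open import Defs
open import Data.Nat using (ℕ)
open import Data.Bool using (_∨_; not)
open import Data.Bool.Properties using (not-involutive; ∨-inverseˡ)
open import Data.Product using (_,_)
open import Data.Sum using (inj₁; inj₂)
open import Relation.Binary.PropositionalEquality using (refl; cong; trans)

¬¬-elim-tautology : (φ : Formula) → Tautology (¬ᶠ ¬ᶠ φ ⇒ φ)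
¬¬-elim-tautology φ v =
  trans (cong (_∨ evalP v φ) (not-involutive (not (evalP v φ)))) (∨-inverseˡ (evalP v φ))

PAT⊢-tautology : (φ : Formula) → Tautology φ → PAT⊢ φ
PAT⊢-tautology φ ⊨φ = logical (taut ⊨φ)

ξ-¬¬ : {X : ℕ → Set} {y : ℕ} → X y → ξ (¬˙ (¬˙ y)) X
ξ-¬¬ {y = y} y∈X = inj₂ (inj₁ (y , refl , y∈X))

Θ-intro : {S : ℕ → Set} (φ ψ : Formula) → ξ (enc φ) S → PAT⊢ (φ ⇒ ψ) → Θ S (enc ψ)
Θ-intro φ ψ ξφ ⊢φ⇒ψ = enc φ , ξφ , (φ ⇒ ψ) , refl , ⊢φ⇒ψ

proposition4p1 : (S : ℕ → Set) → (∀ n → S n → FormulaCode n) → S ⊆ Θ S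
proposition4p1 S formulaCode n n∈S with formulaCode n n∈S
... | φ , refl =
  Θ-intro (¬ᶠ ¬ᶠ φ) φ (ξ-¬¬ n∈S) (PAT⊢-tautology _ (¬¬-elim-tautology φ))
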